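{- Let $G$ be a finite group of even order. Let $I(G)$ be the set of involutions of $G$ and $O(G)$ the set of elements of odd order of $G$. Then (a) every matching of the power graph $P(G)$ leaves at least $|I(G)|-|O(G)|$ vertices unmatched; (b) if $P(G)$ has a perfect matching, then $|I(G)|\le |O(G)|$.
   Context: The power graph $P(G)$ of a finite group $G$ is the simple undirected graph with vertex set $G$ in which distinct $x,y$ are adjacent iff one is a power of the other. A matching is a set of pairwise vertex-disjoint edges; a perfect matching covers every vertex. -}

module Defs where

open import Level using (0ℓ)
open import Data.Nat using (ℕ; zero; suc; _<_; _≤_; _∸_)
open import Data.Nat.Divisibility using (_∣_)
open import Data.Fin using (Fin)
open import Data.Product using (_×_; _,_; ∃; ∃-syntax; proj₁; proj₂)
open import Data.Sum using (_⊎_)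
open import Data.List using (List; []; _∷_; concatMap; length)
open import Data.List.Relation.Unary.All using (All)
open import Data.List.Relation.Unary.Unique.Propositional using (Unique)
open import Data.List.Membership.Propositional using (_∈_)
open import Relation.Nullary using (¬_)
open import Relation.Binary.PropositionalEquality using (_≡_; _≢_)
open import Algebra.Structures using (IsGroup)

record FinGroup (n : ℕ) : Set where
  field
    _∙_     : Fin n → Fin n → Fin n
    ε       : Fin n
    _⁻¹     : Fin n → Fin n
    isGroup : IsGroup _≡_ _∙_ ε _⁻¹

module _ {n : ℕ} (G : FinGroup n) where
  open FinGroup G

  pow : Fin n → ℕ → Fin n
  pow x zero    = ε
  pow x (suc k) = x ∙ pow x k

  IsOrder : Fin n → ℕ → Set
  IsOrder x k = (0 < k) × (pow x k ≡ ε) × (∀ j → 0 < j → j < k → pow x j ≢ ε)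

  Involution : Fin n → Set
  Involution x = IsOrder x 2

  OddOrder : Fin n → Set
  OddOrder x = ∃[ k ] (IsOrder x k × ¬ (2 ∣ k))

  PowerAdj : Fin n → Fin n → Set
  PowerAdj x y = x ≢ y × ((∃[ k ] y ≡ pow x k) ⊎ (∃[ k ] x ≡ pow y k))

  endpoints : List (Fin n × Fin n) → List (Fin n)
  endpoints = concatMap (λ e → proj₁ e ∷ proj₂ e ∷ [])

  record Matching : Set where
    field
      edges     : List (Fin n × Fin n)
      areEdges  : All (λ e → PowerAdj (proj₁ e) (proj₂ e)) edges
      disjoint  : Unique (endpoints edges)

  -- number of vertices left unmatched (endpoints are distinct)
  unmatched : Matching → ℕ
  unmatched M = n ∸ length (endpoints (Matching.edges M))

  Perfect : Matching → Set
  Perfect M = ∀ x → x ∈ endpoints (Matching.edges M)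

-- For an involution t let roots t be the set of y with t ∈ ⟨ y ⟩. Inversion permutes
-- roots t and fixes only t, so |roots t| is odd. Let σ be the partner map of a
-- matching, the identity on unmatched vertices. Since σ is an involution, it cannot
-- map roots t to itself without fixed points, so some root y of t is unmatched or has
-- t ∉ ⟨ σ y ⟩; then σ y ∈ ⟨ y ⟩, and σ y has odd order, for otherwise ⟨ σ y ⟩ would
-- contain an involution, which would be t as a cyclic group has at most one involution.
-- The same uniqueness makes t ↦ σ y injective, from the involutions into the
-- odd-order elements together with the unmatched vertices.
module Submission where

open import Level using (0ℓ)
open import Algebra.Bundles using (Group)
open import Algebra.Structures using (IsGroup)
open import Data.Empty using (⊥-elim)
open import Data.Fin using (Fin; toℕ; fromℕ<)
open import Data.Fin.Properties using (_≟_; any?; pigeonhole; toℕ<n; toℕ-fromℕ<; toℕ-injective)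
open import Data.List using (List; []; _∷_; [_]; _++_; length; filter; allFin; removeAt; concatMap)
open import Data.List.Properties using (length-removeAt′; length-++; length-tabulate; filter-none)
open import Data.List.Membership.Propositional using (_∈_; _∉_)
open import Data.List.Membership.Propositional.Properties
  using (∈-filter⁺; ∈-filter⁻; ∈-allFin; ∈-++⁺ˡ; ∈-++⁺ʳ)
open import Data.List.Relation.Unary.All as All using (All; []; _∷_)
open import Data.List.Relation.Unary.Any as Any using (here; there)
open import Data.List.Relation.Unary.AllPairs using ([]; _∷_)
open import Data.List.Relation.Unary.Unique.Propositional using (Unique)
import Data.List.Relation.Unary.Unique.Propositional.Properties as Unique
open import Data.Nat using (ℕ; zero; suc; _+_; _*_; _∸_; _≤_; _<_; z≤n; s≤s; z<s; s≤s⁻¹; _<?_; _%_; _/_; NonZero; >-nonZero)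
open import Data.Nat.Properties hiding (_≟_)
open import Data.Nat.DivMod using (m≡m%n+[m/n]*n; m%n<n)
open import Data.Nat.Divisibility using (_∣_; divides; _∣?_; m%n≡0⇒n∣m)
open import Data.Nat.Induction using (<-wellFounded)
open import Data.Product using (_×_; _,_; ∃; ∃-syntax; proj₁; proj₂)
open import Data.Sum using (_⊎_; inj₁; inj₂; swap)
open import Function using (_∘_; id)
open import Function.Bundles using (_⇔_; Equivalence)
open import Induction.WellFounded using (Acc; acc)
open import Relation.Binary.Definitions using (DecidableEquality)
open import Relation.Binary.PropositionalEquality
  using (_≡_; _≢_; refl; sym; trans; cong; subst; module ≡-Reasoning)
open import Relation.Nullary using (¬_; Dec; yes; no; _×-dec_; ¬?)
open import Relation.Nullary.Decidable using (map′; decidable-stable)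
open import Relation.Unary using (Pred; Decidable)
open import Relation.Unary.Properties using (∁?)
open import Defs

∈-removeAt : ∀ {a} {A : Set a} {x y : A} {ys} (x∈ys : x ∈ ys) → y ∈ ys → y ≢ x →
             y ∈ removeAt ys (Any.index x∈ys)
∈-removeAt (here refl) (here refl) y≢x = ⊥-elim (y≢x refl)
∈-removeAt (here _)    (there y∈)  _   = y∈
∈-removeAt (there _)   (here refl) _   = here refl
∈-removeAt (there x∈)  (there y∈)  y≢x = there (∈-removeAt x∈ y∈ y≢x)

module _ {a} {A : Set a} where

  length-≤-injectiveOn : ∀ {b} {B : Set b} (f : A → B) {xs ys} → Unique xs →
    (∀ {x y} → x ∈ xs → y ∈ xs → f x ≡ f y → x ≡ y) →
    (∀ {x} → x ∈ xs → f x ∈ ys) →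
    length xs ≤ length ys
  length-≤-injectiveOn f {[]}     _              _   _    = z≤n
  length-≤-injectiveOn f {x ∷ xs} {ys} (x∉xs ∷ xs!) inj maps =
    ≤-trans (s≤s (length-≤-injectiveOn f xs! (λ p q → inj (there p) (there q)) mapsRest))
            (≤-reflexive (sym (length-removeAt′ ys (Any.index fx∈ys))))
    where
    fx∈ys = maps (here refl)
    mapsRest : ∀ {y} → y ∈ xs → f y ∈ removeAt ys (Any.index fx∈ys)
    mapsRest y∈xs = ∈-removeAt fx∈ys (maps (there y∈xs))
      (λ fy≡fx → All.lookup x∉xs y∈xs (sym (inj (there y∈xs) (here refl) fy≡fx)))

  length-≤-⊆ : ∀ {xs ys : List A} → Unique xs → (∀ {x} → x ∈ xs → x ∈ ys) →
               length xs ≤ length ys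
  length-≤-⊆ xs! = length-≤-injectiveOn id xs! (λ _ _ → id)

  length-filter-∁ : ∀ {p} {P : Pred A p} (P? : Decidable P) xs →
    length (filter P? xs) + length (filter (∁? P?) xs) ≡ length xs
  length-filter-∁ P? []       = refl
  length-filter-∁ P? (x ∷ xs) with P? x
  ... | yes _ = cong suc (length-filter-∁ P? xs)
  ... | no  _ = trans (+-suc _ _) (cong suc (length-filter-∁ P? xs))

module _ {p} {P : ℕ → Set p} (P? : Decidable P) where

  private
    least-witness-acc : ∀ {k} → Acc _<_ k → P k →
      ∃[ m ] m ≤ k × P m × (∀ j → j < m → ¬ P j)
    least-witness-acc {k} (acc rec) pk with anyUpTo? P? k
    ... | no none = k , ≤-refl , pk , λ j j<k pj → none (j , j<k , pj)
    ... | yes (j , j<k , pj) with least-witness-acc (rec j<k) pj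
    ...   | m , m≤j , rest = m , ≤-trans m≤j (<⇒≤ j<k) , rest

  least-witness : ∀ {k} → P k → ∃[ m ] m ≤ k × P m × (∀ j → j < m → ¬ P j)
  least-witness = least-witness-acc (<-wellFounded _)

module _ {n} {σ : Fin n → Fin n} (σ-involutive : ∀ x → σ (σ x) ≡ x) where

  private
    σ-injective : ∀ {x y} → σ x ≡ σ y → x ≡ y
    σ-injective {x} {y} σx≡σy = trans (sym (σ-involutive x)) (trans (cong σ σx≡σy) (σ-involutive y))

    fixed? : Decidable (λ x → σ x ≡ x)
    fixed? x = σ x ≟ x

    ascending? : Decidable (λ x → toℕ x < toℕ (σ x))
    ascending? x = toℕ x <? toℕ (σ x)

  -- The non-fixed points split into those x with x < σ x and those with σ x < x,
  -- and σ is a bijection between the two halves.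
  length≡fixedPoints+even : ∀ {xs} → Unique xs → (∀ {x} → x ∈ xs → σ x ∈ xs) →
    ∃[ k ] length xs ≡ length (filter fixed? xs) + 2 * k
  length≡fixedPoints+even {xs} xs! closed = length As , (begin
    length xs                            ≡⟨ length-filter-∁ fixed? xs ⟨
    length (filter fixed? xs) + length R ≡⟨ cong (length (filter fixed? xs) +_) |R|≡ ⟩
    length (filter fixed? xs) + 2 * length As ∎)
    where
    open ≡-Reasoning
    R  = filter (∁? fixed?) xs
    As = filter ascending? R
    Bs = filter (∁? ascending?) R

    R! : Unique R
    R! = Unique.filter⁺ (∁? fixed?) xs!

    R-closed : ∀ {x} → x ∈ R → σ x ∈ R
    R-closed {x} x∈R with ∈-filter⁻ (∁? fixed?) {xs = xs} x∈R
    ... | x∈xs , σx≢x = ∈-filter⁺ (∁? fixed?) (closed x∈xs)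
                          (λ σσx≡σx → σx≢x (σ-injective σσx≡σx))

    As→Bs : ∀ {x} → x ∈ As → σ x ∈ Bs
    As→Bs {x} x∈As with ∈-filter⁻ ascending? {xs = R} x∈As
    ... | x∈R , x<σx = ∈-filter⁺ (∁? ascending?) (R-closed x∈R)
            (λ σx<σσx → <-asym x<σx (subst (λ z → toℕ (σ x) < toℕ z) (σ-involutive x) σx<σσx))

    Bs→As : ∀ {x} → x ∈ Bs → σ x ∈ As
    Bs→As {x} x∈Bs with ∈-filter⁻ (∁? ascending?) {xs = R} x∈Bs
    ... | x∈R , x≮σx = ∈-filter⁺ ascending? (R-closed x∈R)
            (subst (λ z → toℕ (σ x) < toℕ z) (sym (σ-involutive x))
              (≤∧≢⇒< (≮⇒≥ x≮σx) (λ σx≡x → σx≢x (toℕ-injective σx≡x))))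
      where σx≢x = proj₂ (∈-filter⁻ (∁? fixed?) {xs = xs} x∈R)

    |R|≡ : length R ≡ 2 * length As
    |R|≡ = begin
      length R              ≡⟨ length-filter-∁ ascending? R ⟨
      length As + length Bs ≡⟨ cong (length As +_) (≤-antisym
                                 (length-≤-injectiveOn σ (Unique.filter⁺ (∁? ascending?) R!)
                                    (λ _ _ → σ-injective) Bs→As)
                                 (length-≤-injectiveOn σ (Unique.filter⁺ ascending? R!)
                                    (λ _ _ → σ-injective) As→Bs)) ⟩
      length As + length As ≡⟨ cong (length As +_) (+-identityʳ (length As)) ⟨
      2 * length As ∎

  fixedPointFree⇒even : ∀ {xs} → Unique xs → (∀ {x} → x ∈ xs → σ x ∈ xs) →
    (∀ {x} → x ∈ xs → σ x ≢ x) → ∃[ k ] length xs ≡ 2 * k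
  fixedPointFree⇒even {xs} xs! closed free with length≡fixedPoints+even xs! closed
  ... | k , |xs|≡ = k , trans |xs|≡ (cong (λ fs → length fs + 2 * k) (filter-none fixed? (All.tabulate free)))

  uniqueFixedPoint⇒odd : ∀ {xs t} → Unique xs → (∀ {x} → x ∈ xs → σ x ∈ xs) →
    t ∈ xs → σ t ≡ t → (∀ {x} → x ∈ xs → σ x ≡ x → x ≡ t) → ∃[ k ] length xs ≡ suc (2 * k)
  uniqueFixedPoint⇒odd {xs} {t} xs! closed t∈xs σt≡t onlyT with length≡fixedPoints+even xs! closed
  ... | k , |xs|≡ = k , trans |xs|≡ (cong (_+ 2 * k) (≤-antisym
          (length-≤-⊆ {ys = [ t ]} (Unique.filter⁺ fixed? xs!) (here ∘ onlyT′))
          (length-≤-⊆ {ys = filter fixed? xs} ([] ∷ []) λ { (here refl) → ∈-filter⁺ fixed? t∈xs σt≡t })))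
    where
    onlyT′ : ∀ {x} → x ∈ filter fixed? xs → x ≡ t
    onlyT′ x∈ = let x∈xs , σx≡x = ∈-filter⁻ fixed? {xs = xs} x∈ in onlyT x∈xs σx≡x

module GroupPowers {n : ℕ} (G : FinGroup n) where

  open FinGroup G
  open IsGroup isGroup using (assoc; identityˡ; identityʳ; inverseˡ; inverseʳ)
  open ≡-Reasoning

  private
    group : Group 0ℓ 0ℓ
    group = record { isGroup = isGroup }

  open import Algebra.Properties.Group group using (inverseˡ-unique; identityˡ-unique; ⁻¹-involutive)

  infixr 30 _^_
  _^_ : Fin n → ℕ → Fin n
  x ^ k = pow G x k

  ^-+ : ∀ x a b → x ^ (a + b) ≡ x ^ a ∙ x ^ b
  ^-+ x zero    b = sym (identityˡ _)
  ^-+ x (suc a) b = trans (cong (x ∙_) (^-+ x a b)) (sym (assoc _ _ _))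

  ^-* : ∀ x a b → x ^ (a * b) ≡ (x ^ b) ^ a
  ^-* x zero    b = refl
  ^-* x (suc a) b = trans (^-+ x b (a * b)) (cong (x ^ b ∙_) (^-* x a b))

  ε^ : ∀ k → ε ^ k ≡ ε
  ε^ zero    = refl
  ε^ (suc k) = trans (identityˡ _) (ε^ k)

  ^-suc′ : ∀ x k → x ^ suc k ≡ x ^ k ∙ x
  ^-suc′ x k = begin
    x ^ suc k       ≡⟨ cong (x ^_) (+-comm 1 k) ⟩
    x ^ (k + 1)     ≡⟨ ^-+ x k 1 ⟩
    x ^ k ∙ x ^ 1   ≡⟨ cong (x ^ k ∙_) (identityʳ x) ⟩
    x ^ k ∙ x       ∎

  ⁻¹^∙^ : ∀ x k → (x ⁻¹) ^ k ∙ x ^ k ≡ ε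
  ⁻¹^∙^ x zero    = identityˡ ε
  ⁻¹^∙^ x (suc k) = begin
    (x⁻¹ ∙ y) ∙ x ^ suc k  ≡⟨ cong ((x⁻¹ ∙ y) ∙_) (^-suc′ x k) ⟩
    (x⁻¹ ∙ y) ∙ (z ∙ x)    ≡⟨ assoc _ _ _ ⟩
    x⁻¹ ∙ (y ∙ (z ∙ x))    ≡⟨ cong (x⁻¹ ∙_) (assoc _ _ _) ⟨
    x⁻¹ ∙ ((y ∙ z) ∙ x)    ≡⟨ cong (λ w → x⁻¹ ∙ (w ∙ x)) (⁻¹^∙^ x k) ⟩
    x⁻¹ ∙ (ε ∙ x)          ≡⟨ cong (x⁻¹ ∙_) (identityˡ x) ⟩
    x⁻¹ ∙ x                ≡⟨ inverseˡ x ⟩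
    ε                      ∎
    where x⁻¹ = x ⁻¹; y = x⁻¹ ^ k; z = x ^ k

  ⁻¹-^ : ∀ x k → (x ⁻¹) ^ k ≡ (x ^ k) ⁻¹
  ⁻¹-^ x k = inverseˡ-unique _ _ (⁻¹^∙^ x k)

  period : ∀ x → ∃[ p ] 0 < p × p ≤ n × x ^ p ≡ ε
  period x with pigeonhole (n<1+n n) (λ (i : Fin (suc n)) → x ^ toℕ i)
  ... | i , j , i<j , x^i≡x^j = toℕ j ∸ toℕ i , m<n⇒0<n∸m i<j
      , ≤-trans (m∸n≤m (toℕ j) (toℕ i)) (s≤s⁻¹ (toℕ<n j))
      , identityˡ-unique _ _ (begin
          x ^ (toℕ j ∸ toℕ i) ∙ x ^ toℕ i ≡⟨ ^-+ x (toℕ j ∸ toℕ i) (toℕ i) ⟨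
          x ^ (toℕ j ∸ toℕ i + toℕ i)     ≡⟨ cong (x ^_) (m∸n+n≡m (<⇒≤ i<j)) ⟩
          x ^ toℕ j                        ≡⟨ x^i≡x^j ⟨
          x ^ toℕ i                        ∎)

  order : ∀ x → ∃[ m ] IsOrder G x m × m ≤ n
  order x with period x
  ... | p , 0<p , p≤n , x^p≡ε with least-witness (λ j → (0 <? j) ×-dec (x ^ j ≟ ε)) (0<p , x^p≡ε)
  ...   | m , m≤p , (0<m , x^m≡ε) , below =
    m , (0<m , x^m≡ε , λ j 0<j j<m x^j≡ε → below j j<m (0<j , x^j≡ε)) , ≤-trans m≤p p≤n

  ^-% : ∀ {x m} .{{_ : NonZero m}} → IsOrder G x m → ∀ a → x ^ a ≡ x ^ (a % m)
  ^-% {x} {m} (_ , x^m≡ε , _) a = begin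
    x ^ a                         ≡⟨ cong (x ^_) (m≡m%n+[m/n]*n a m) ⟩
    x ^ (a % m + a / m * m)       ≡⟨ ^-+ x (a % m) (a / m * m) ⟩
    x ^ (a % m) ∙ x ^ (a / m * m) ≡⟨ cong (x ^ (a % m) ∙_) (^-* x (a / m) m) ⟩
    x ^ (a % m) ∙ (x ^ m) ^ (a / m) ≡⟨ cong (λ w → x ^ (a % m) ∙ w ^ (a / m)) x^m≡ε ⟩
    x ^ (a % m) ∙ ε ^ (a / m)     ≡⟨ cong (x ^ (a % m) ∙_) (ε^ (a / m)) ⟩
    x ^ (a % m) ∙ ε               ≡⟨ identityʳ _ ⟩
    x ^ (a % m)                   ∎

  order-∣ : ∀ {x m} → IsOrder G x m → ∀ {a} → x ^ a ≡ ε → m ∣ a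
  order-∣ {x} {suc m} o@(_ , _ , minimal) {a} x^a≡ε with a % suc m in a%m≡r
  ... | zero  = m%n≡0⇒n∣m a (suc m) a%m≡r
  ... | suc r = ⊥-elim (minimal (suc r) z<s (subst (_< suc m) a%m≡r (m%n<n a (suc m)))
                  (trans (cong (x ^_) (sym a%m≡r)) (trans (sym (^-% o a)) x^a≡ε)))

  infix 4 _∈⟨_⟩ _∉⟨_⟩
  _∈⟨_⟩ : Fin n → Fin n → Set
  x ∈⟨ y ⟩ = ∃[ k ] x ≡ y ^ k

  _∉⟨_⟩ : Fin n → Fin n → Set
  x ∉⟨ y ⟩ = ¬ x ∈⟨ y ⟩

  ∈⟨⟩-refl : ∀ x → x ∈⟨ x ⟩
  ∈⟨⟩-refl x = 1 , sym (identityʳ x)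

  ∈⟨⟩-trans : ∀ {x y z} → x ∈⟨ y ⟩ → y ∈⟨ z ⟩ → x ∈⟨ z ⟩
  ∈⟨⟩-trans {z = z} (a , refl) (b , refl) = a * b , sym (^-* z a b)

  _∈⟨_⟩? : ∀ x y → Dec (x ∈⟨ y ⟩)
  x ∈⟨ y ⟩? = map′ (λ (i , x≡) → toℕ i , x≡) reduce (any? (λ i → x ≟ y ^ toℕ i))
    where
    reduce : x ∈⟨ y ⟩ → ∃[ i ] x ≡ y ^ toℕ i
    reduce (a , x≡y^a) with order y
    ... | suc m , o , m<n = fromℕ< a%m<n
        , trans x≡y^a (trans (^-% o a) (cong (y ^_) (sym (toℕ-fromℕ< a%m<n))))
      where a%m<n = <-≤-trans (m%n<n a (suc m)) m<n

  involution≢ε : ∀ {t} → Involution G t → t ≢ ε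
  involution≢ε {t} (_ , _ , minimal) t≡ε = minimal 1 z<s (s≤s z<s) (trans (identityʳ t) t≡ε)

  involution-square : ∀ {t} → Involution G t → t ∙ t ≡ ε
  involution-square {t} (_ , t^2≡ε , _) = trans (cong (t ∙_) (sym (identityʳ t))) t^2≡ε

  involution-⁻¹ : ∀ {t} → Involution G t → t ⁻¹ ≡ t
  involution-⁻¹ {t} it = sym (inverseˡ-unique t t (involution-square it))

  involution-exponent : ∀ {y m a} .{{_ : NonZero m}} → IsOrder G y m → Involution G (y ^ a) →
                        2 * (a % m) ≡ m
  involution-exponent {y} {m} {a} o it = exponent (order-∣ o y^2r≡ε)
    where
    r = a % m
    y^2r≡ε : y ^ (2 * r) ≡ ε
    y^2r≡ε = begin
      y ^ (2 * r)  ≡⟨ ^-* y 2 r ⟩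
      (y ^ r) ^ 2  ≡⟨ cong (_^ 2) (^-% o a) ⟨
      (y ^ a) ^ 2  ≡⟨ proj₁ (proj₂ it) ⟩
      ε            ∎
    exponent : m ∣ 2 * r → 2 * r ≡ m
    exponent (divides zero 2r≡0) = ⊥-elim (involution≢ε it (begin
      y ^ a  ≡⟨ ^-% o a ⟩
      y ^ r  ≡⟨ cong (y ^_) (m+n≡0⇒m≡0 r 2r≡0) ⟩
      ε      ∎))
    exponent (divides 1 2r≡m) = trans 2r≡m (+-identityʳ m)
    exponent (divides (suc (suc q)) 2r≡qm) = ⊥-elim (<-irrefl 2r≡qm
      (<-≤-trans (*-monoʳ-< 2 (m%n<n a m)) (*-monoˡ-≤ m {2} {suc (suc q)} (s≤s (s≤s z≤n)))))

  involutions-∈⟨⟩-unique : ∀ {t s y} → Involution G t → Involution G s → t ∈⟨ y ⟩ → s ∈⟨ y ⟩ → t ≡ s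
  involutions-∈⟨⟩-unique {y = y} it is (a , refl) (b , refl) with order y
  ... | suc m , o , _ = begin
    y ^ a       ≡⟨ ^-% o a ⟩
    y ^ (a % suc m) ≡⟨ cong (y ^_) (*-cancelˡ-≡ (a % suc m) (b % suc m) 2
                         (trans (involution-exponent {a = a} o it) (sym (involution-exponent {a = b} o is)))) ⟩
    y ^ (b % suc m) ≡⟨ ^-% o b ⟨
    y ^ b       ∎

  even-order⇒involution : ∀ {z m} → IsOrder G z m → 2 ∣ m → ∃[ h ] Involution G (z ^ h)
  even-order⇒involution {z} {m} (0<m , z^m≡ε , minimal) (divides h m≡h*2) =
    h , z<s , z^h^2≡ε ,
    λ { .1 z<s (s≤s (s≤s z≤n)) z^h^1≡ε → minimal h 0<h h<m (trans (sym (identityʳ _)) z^h^1≡ε) }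
    where
    m≡2h : m ≡ 2 * h
    m≡2h = trans m≡h*2 (*-comm h 2)
    0<h : 0 < h
    0<h = n≢0⇒n>0 λ { refl → <-irrefl (sym m≡2h) 0<m }
    h<m : h < m
    h<m = subst (h <_) (sym m≡h*2) (m<m*n h 2 {{>-nonZero 0<h}} (s≤s (s≤s z≤n)))
    z^h^2≡ε : (z ^ h) ^ 2 ≡ ε
    z^h^2≡ε = trans (sym (^-* z 2 h)) (trans (cong (z ^_) (sym m≡2h)) z^m≡ε)

  odd-order-of-power : ∀ {t y z} → Involution G t → t ∈⟨ y ⟩ → z ∈⟨ y ⟩ → t ∉⟨ z ⟩ → OddOrder G z
  odd-order-of-power {t} {y} {z} it t∈⟨y⟩ z∈⟨y⟩ t∉⟨z⟩ with order z
  ... | m , o , _ with 2 ∣? m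
  ...   | no 2∤m = m , o , 2∤m
  ...   | yes 2∣m with even-order⇒involution o 2∣m
  ...     | h , ih = ⊥-elim (t∉⟨z⟩ (h , involutions-∈⟨⟩-unique it ih t∈⟨y⟩ (∈⟨⟩-trans (h , refl) z∈⟨y⟩)))

  square-ε⇒powers : ∀ {y} → y ∙ y ≡ ε → ∀ a → y ^ a ≡ ε ⊎ y ^ a ≡ y
  square-ε⇒powers y∙y≡ε zero = inj₁ refl
  square-ε⇒powers {y} y∙y≡ε (suc a) with square-ε⇒powers y∙y≡ε a
  ... | inj₁ y^a≡ε = inj₂ (trans (cong (y ∙_) y^a≡ε) (identityʳ y))
  ... | inj₂ y^a≡y = inj₁ (trans (cong (y ∙_) y^a≡y) y∙y≡ε)

  roots : Fin n → List (Fin n)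
  roots t = filter (t ∈⟨_⟩?) (allFin n)

  roots-unique : ∀ t → Unique (roots t)
  roots-unique t = Unique.filter⁺ (t ∈⟨_⟩?) (Unique.allFin⁺ n)

  ∈-roots⁺ : ∀ {t y} → t ∈⟨ y ⟩ → y ∈ roots t
  ∈-roots⁺ {t} = ∈-filter⁺ (t ∈⟨_⟩?) (∈-allFin _)

  ∈-roots⁻ : ∀ {t y} → y ∈ roots t → t ∈⟨ y ⟩
  ∈-roots⁻ {t} y∈ = proj₂ (∈-filter⁻ (t ∈⟨_⟩?) {xs = allFin n} y∈)

  roots-odd : ∀ {t} → Involution G t → ∃[ k ] length (roots t) ≡ suc (2 * k)
  roots-odd {t} it = uniqueFixedPoint⇒odd ⁻¹-involutive (roots-unique t)
    (λ y∈ → ∈-roots⁺ (inverse-root (∈-roots⁻ y∈)))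
    (∈-roots⁺ (∈⟨⟩-refl t)) (involution-⁻¹ it)
    (λ y∈ y⁻¹≡y → involutive-root (∈-roots⁻ y∈) y⁻¹≡y)
    where
    inverse-root : ∀ {y} → t ∈⟨ y ⟩ → t ∈⟨ y ⁻¹ ⟩
    inverse-root {y} (a , t≡y^a) = a , (begin
      t             ≡⟨ involution-⁻¹ it ⟨
      t ⁻¹          ≡⟨ cong _⁻¹ t≡y^a ⟩
      (y ^ a) ⁻¹    ≡⟨ ⁻¹-^ y a ⟨
      (y ⁻¹) ^ a    ∎)
    involutive-root : ∀ {y} → t ∈⟨ y ⟩ → y ⁻¹ ≡ y → y ≡ t
    involutive-root {y} (a , t≡y^a) y⁻¹≡y
      with square-ε⇒powers (trans (cong (y ∙_) (sym y⁻¹≡y)) (inverseʳ y)) a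
    ... | inj₁ y^a≡ε = ⊥-elim (involution≢ε it (trans t≡y^a y^a≡ε))
    ... | inj₂ y^a≡y = sym (trans t≡y^a y^a≡y)

  PowerAdj-sym : ∀ {x y} → PowerAdj G x y → PowerAdj G y x
  PowerAdj-sym (x≢y , adj) = x≢y ∘ sym , swap adj

module _ {a} {A : Set a} (_≟ᴬ_ : DecidableEquality A) where

  open import Data.List.Membership.DecPropositional _≟ᴬ_ using (_∈?_)

  -- Definitionally equal to endpoints G, which does not actually depend on G.
  vertices : List (A × A) → List A
  vertices = concatMap (λ e → proj₁ e ∷ proj₂ e ∷ [])

  partner : List (A × A) → A → A
  partner []             y = y
  partner ((u , v) ∷ es) y with y ≟ᴬ u | y ≟ᴬ v
  ... | yes _ | _     = v
  ... | no _  | yes _ = u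
  ... | no _  | no _  = partner es y

  private
    partner-head₁ : ∀ u v es → partner ((u , v) ∷ es) u ≡ v
    partner-head₁ u v es with u ≟ᴬ u
    ... | yes _  = refl
    ... | no u≢u = ⊥-elim (u≢u refl)

    partner-head₂ : ∀ {u v} es → u ≢ v → partner ((u , v) ∷ es) v ≡ u
    partner-head₂ {u} {v} es u≢v with v ≟ᴬ u | v ≟ᴬ v
    ... | yes v≡u | _      = ⊥-elim (u≢v (sym v≡u))
    ... | no _    | yes _  = refl
    ... | no _    | no v≢v = ⊥-elim (v≢v refl)

    partner-tail : ∀ {u v y} es → y ≢ u → y ≢ v → partner ((u , v) ∷ es) y ≡ partner es y
    partner-tail {u} {v} {y} es y≢u y≢v with y ≟ᴬ u | y ≟ᴬ v
    ... | yes y≡u | _       = ⊥-elim (y≢u y≡u)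
    ... | no _    | yes y≡v = ⊥-elim (y≢v y≡v)
    ... | no _    | no _    = refl

    ∈-vertices⁺ : ∀ {es u v} → (u , v) ∈ es → u ∈ vertices es × v ∈ vertices es
    ∈-vertices⁺ (here refl) = here refl , there (here refl)
    ∈-vertices⁺ (there uv∈) = let u∈ , v∈ = ∈-vertices⁺ uv∈ in there (there u∈) , there (there v∈)

    ∈-vertices⁻ : ∀ {es y} → y ∈ vertices es → ∃[ u ] ∃[ v ] (u , v) ∈ es × (y ≡ u ⊎ y ≡ v)
    ∈-vertices⁻ {(u , v) ∷ _} (here y≡u)         = u , v , here refl , inj₁ y≡u
    ∈-vertices⁻ {(u , v) ∷ _} (there (here y≡v)) = u , v , here refl , inj₂ y≡v
    ∈-vertices⁻ {_ ∷ _}       (there (there y∈)) =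
      let u , v , uv∈ , y≡ = ∈-vertices⁻ y∈ in u , v , there uv∈ , y≡

  partner-unmatched : ∀ es {y} → y ∉ vertices es → partner es y ≡ y
  partner-unmatched []             _  = refl
  partner-unmatched ((u , v) ∷ es) y∉ =
    trans (partner-tail es (y∉ ∘ here) (y∉ ∘ there ∘ here)) (partner-unmatched es (y∉ ∘ there ∘ there))

  partner-edge : ∀ es {u v} → Unique (vertices es) → (u , v) ∈ es →
                 partner es u ≡ v × partner es v ≡ u
  partner-edge ((u , v) ∷ es) ((u≢v ∷ _) ∷ _) (here refl) =
    partner-head₁ u v es , partner-head₂ es u≢v
  partner-edge ((c , d) ∷ es) {u} {v} (c∉ ∷ d∉ ∷ es!) (there uv∈) =
    trans (partner-tail es (distinct-c u∈) (distinct-d u∈)) (proj₁ (partner-edge es es! uv∈)) ,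
    trans (partner-tail es (distinct-c v∈) (distinct-d v∈)) (proj₂ (partner-edge es es! uv∈))
    where
    u∈ = proj₁ (∈-vertices⁺ uv∈)
    v∈ = proj₂ (∈-vertices⁺ uv∈)
    distinct-c : ∀ {y} → y ∈ vertices es → y ≢ c
    distinct-c y∈ y≡c = All.lookup c∉ (there y∈) (sym y≡c)
    distinct-d : ∀ {y} → y ∈ vertices es → y ≢ d
    distinct-d y∈ y≡d = All.lookup d∉ y∈ (sym y≡d)

  partner-matched : ∀ es {y} → Unique (vertices es) → y ∈ vertices es →
                    (y , partner es y) ∈ es ⊎ (partner es y , y) ∈ es
  partner-matched es es! y∈ with ∈-vertices⁻ y∈
  ... | u , v , uv∈ , inj₁ refl = inj₁ (subst (λ w → (u , w) ∈ es) (sym (proj₁ (partner-edge es es! uv∈))) uv∈)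
  ... | u , v , uv∈ , inj₂ refl = inj₂ (subst (λ w → (w , v) ∈ es) (sym (proj₂ (partner-edge es es! uv∈))) uv∈)

  partner-involutive : ∀ es → Unique (vertices es) → ∀ y → partner es (partner es y) ≡ y
  partner-involutive es es! y with y ∈? vertices es
  ... | no y∉  = trans (cong (partner es) (partner-unmatched es y∉)) (partner-unmatched es y∉)
  ... | yes y∈ with partner-matched es es! y∈
  ...   | inj₁ e = proj₂ (partner-edge es es! e)
  ...   | inj₂ e = proj₁ (partner-edge es es! e)

module _ {n : ℕ} (G : FinGroup n) (M : Matching G) where

  open FinGroup G
  open GroupPowers G
  open Matching M
  open import Data.List.Membership.DecPropositional (_≟_ {n}) using (_∈?_)

  private
    V : List (Fin n)
    V = endpoints G edges

    σ : Fin n → Fin n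
    σ = partner _≟_ edges

    σ-involutive : ∀ y → σ (σ y) ≡ y
    σ-involutive = partner-involutive _≟_ edges disjoint

  unmatchedVertices : List (Fin n)
  unmatchedVertices = filter (λ y → ¬? (y ∈? V)) (allFin n)

  unmatched+matched≤n : length unmatchedVertices + length V ≤ n
  unmatched+matched≤n = begin
    length unmatchedVertices + length V  ≤⟨ +-monoʳ-≤ (length unmatchedVertices)
                                              (length-≤-⊆ disjoint (∈-filter⁺ (_∈? V) (∈-allFin _))) ⟩
    length unmatchedVertices + length Vs ≡⟨ +-comm (length unmatchedVertices) (length Vs) ⟩
    length Vs + length unmatchedVertices ≡⟨ length-filter-∁ (_∈? V) (allFin n) ⟩
    length (allFin n)                    ≡⟨ length-tabulate id ⟩
    n                                    ∎
    where
    open ≤-Reasoning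
    Vs = filter (_∈? V) (allFin n)

  perfect⇒unmatchedVertices≡[] : Perfect G M → unmatchedVertices ≡ []
  perfect⇒unmatchedVertices≡[] perfect =
    filter-none (λ y → ¬? (y ∈? V)) {xs = allFin n} (All.tabulate (λ _ y∉ → y∉ (perfect _)))

  partner-adjacent : ∀ {y} → y ∈ V → PowerAdj G y (σ y)
  partner-adjacent y∈ with partner-matched _≟_ edges disjoint y∈
  ... | inj₁ e = All.lookup areEdges e
  ... | inj₂ e = PowerAdj-sym (All.lookup areEdges e)

  GoodRoot : Fin n → Fin n → Set
  GoodRoot t y = t ∈⟨ y ⟩ × ¬ (y ∈ V × t ∈⟨ σ y ⟩)

  GoodRoot? : ∀ t → Decidable (GoodRoot t)
  GoodRoot? t y = (t ∈⟨ y ⟩?) ×-dec ¬? ((y ∈? V) ×-dec (t ∈⟨ σ y ⟩?))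

  ¬¬goodRoot : ∀ {t} → Involution G t → ¬ ¬ ∃ (GoodRoot t)
  ¬¬goodRoot {t} it none = even≢odd (proj₁ even) (proj₁ odd) (trans (sym (proj₂ even)) (proj₂ odd))
    where
    forced : ∀ {y} → y ∈ roots t → y ∈ V × t ∈⟨ σ y ⟩
    forced {y} y∈ = decidable-stable ((y ∈? V) ×-dec (t ∈⟨ σ y ⟩?)) (λ ¬p → none (y , ∈-roots⁻ y∈ , ¬p))
    even : ∃[ k ] length (roots t) ≡ 2 * k
    even = fixedPointFree⇒even σ-involutive (roots-unique t) (∈-roots⁺ ∘ proj₂ ∘ forced)
             (λ y∈ → proj₁ (partner-adjacent (proj₁ (forced y∈))) ∘ sym)
    odd : ∃[ l ] length (roots t) ≡ suc (2 * l)
    odd = roots-odd it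

  goodRoot : Fin n → Fin n
  goodRoot t with any? (GoodRoot? t)
  ... | yes (y , _) = y
  ... | no _        = t

  goodRoot-good : ∀ {t} → Involution G t → GoodRoot t (goodRoot t)
  goodRoot-good {t} it with any? (GoodRoot? t)
  ... | yes (_ , good) = good
  ... | no none        = ⊥-elim (¬¬goodRoot it none)

  partner-goodRoot-odd : ∀ {t y} → Involution G t → GoodRoot t y → y ∈ V → OddOrder G (σ y)
  partner-goodRoot-odd {t} {y} it (t∈⟨y⟩ , bad) y∈ with proj₂ (partner-adjacent y∈)
  ... | inj₁ σy∈⟨y⟩ = odd-order-of-power it t∈⟨y⟩ σy∈⟨y⟩ (λ t∈⟨σy⟩ → bad (y∈ , t∈⟨σy⟩))
  ... | inj₂ y∈⟨σy⟩ = ⊥-elim (bad (y∈ , ∈⟨⟩-trans t∈⟨y⟩ y∈⟨σy⟩))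

  involutions≤oddOrder+unmatched : ∀ {Is Os} → Unique Is → (∀ {t} → t ∈ Is → Involution G t) →
    (∀ {z} → OddOrder G z → z ∈ Os) → length Is ≤ length Os + length unmatchedVertices
  involutions≤oddOrder+unmatched {Is} {Os} Is! Is-inv Os-odd =
    ≤-trans (length-≤-injectiveOn (σ ∘ goodRoot) Is! injective maps) (≤-reflexive (length-++ Os))
    where
    injective : ∀ {t s} → t ∈ Is → s ∈ Is → σ (goodRoot t) ≡ σ (goodRoot s) → t ≡ s
    injective {t} {s} t∈ s∈ σgt≡σgs = involutions-∈⟨⟩-unique (Is-inv t∈) (Is-inv s∈)
      (proj₁ (goodRoot-good (Is-inv t∈)))
      (subst (s ∈⟨_⟩) (sym gt≡gs) (proj₁ (goodRoot-good (Is-inv s∈))))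
      where
      gt≡gs = trans (sym (σ-involutive _)) (trans (cong σ σgt≡σgs) (σ-involutive _))
    maps : ∀ {t} → t ∈ Is → σ (goodRoot t) ∈ Os ++ unmatchedVertices
    maps {t} t∈ with goodRoot t ∈? V
    ... | yes y∈ = ∈-++⁺ˡ (Os-odd (partner-goodRoot-odd (Is-inv t∈) (goodRoot-good (Is-inv t∈)) y∈))
    ... | no  y∉ = ∈-++⁺ʳ Os (subst (_∈ unmatchedVertices) (sym (partner-unmatched _≟_ edges y∉))
                                (∈-filter⁺ (λ y → ¬? (y ∈? V)) (∈-allFin _) y∉))

mainTheorem3 : ∀ {n} (G : FinGroup n) → 2 ∣ n →
    (Is Os : List (Fin n)) →
    Unique Is → (∀ x → (x ∈ Is) ⇔ Involution G x) →
    Unique Os → (∀ x → (x ∈ Os) ⇔ OddOrder G x) →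
    ((M : Matching G) → length Is ∸ length Os ≤ unmatched G M)
    × ((M : Matching G) → Perfect G M → length Is ≤ length Os)
mainTheorem3 G _ Is Os Is! Is-inv _ Os-odd = unmatched-bound , perfect-bound
  where
  bound : ∀ M → length Is ≤ length Os + length (unmatchedVertices G M)
  bound M = involutions≤oddOrder+unmatched G M Is!
    (Equivalence.to (Is-inv _)) (Equivalence.from (Os-odd _))

  unmatched-bound : ∀ M → length Is ∸ length Os ≤ unmatched G M
  unmatched-bound M = ≤-trans (m≤n+o⇒m∸n≤o (length Is) (length Os) (bound M))
                              (m+n≤o⇒m≤o∸n _ (unmatched+matched≤n G M))

  perfect-bound : ∀ M → Perfect G M → length Is ≤ length Os
  perfect-bound M perfect = subst (length Is ≤_)
    (trans (cong (λ us → length Os + length us) (perfect⇒unmatchedVertices≡[] G M perfect)) (+-identityʳ _))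
    (bound M)
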